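{- Let $n\ge 1$ and let $\frac{a}{b}$ and $\frac{a'}{b'}$ be two neighboring terms of the Farey sequence for $n$. Let $(x_1,y_1)$ and $(x_2,y_2)$ be (the coordinates of) two boxes of a Young diagram with $n$ boxes. Then it is impossible that simultaneously $$a' x_1-(b'-a')y_1 < a' x_2-(b'-a')y_2 \quad\text{and}\quad a x_1-(b-a)y_1 > a x_2-(b-a)y_2 .$$
   Context: The Farey sequence for $n$ is the increasing sequence of all rational numbers in $[0,1]$ whose denominator (in lowest terms) is at most $n$; fractions $\frac{a}{b}$ are written in lowest terms with $a,b\ge 0$ integers. Young diagrams are drawn in the fourth quadrant ($x>0$, $y<0$) in English convention, with the top row along the $x$-axis and the left column along the $y$-axis; a box in column $i\ge1$ and row $j\ge1$ is given the integer coordinates $(x,y)=(i,-j)$ (so $y$ decreases going down). -}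

module Defs where

open import Data.Nat as ℕ using (ℕ; suc)
open import Data.Nat.GCD using (gcd)
open import Data.List using (List; []; _∷_; length; lookup)
open import Data.Nat.ListAction using (sum)
open import Data.Fin using (Fin; toℕ)
open import Data.Integer as ℤ using (ℤ; +_; -_; _*_; _-_)
open import Data.Product using (_×_; Σ; ∃-syntax; _,_)
open import Relation.Binary.PropositionalEquality using (_≡_)
open import Data.Empty using (⊥)
open import Relation.Nullary using (¬_)

record FareyTerm (n : ℕ) (a b : ℕ) : Set where
  field
    den-pos : 1 ℕ.≤ b
    den≤n   : b ℕ.≤ n
    num≤den : a ℕ.≤ b
    coprime : gcd a b ≡ 1

_/_<ᶠ_/_ : ℕ → ℕ → ℕ → ℕ → Set
a / b <ᶠ c / d = a ℕ.* d ℕ.< c ℕ.* b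

record FareyNeighbours (n a b a' b' : ℕ) : Set where
  field
    left     : FareyTerm n a b
    right    : FareyTerm n a' b'
    ordered  : a / b <ᶠ a' / b'
    adjacent : ∀ c d → 1 ℕ.≤ d → d ℕ.≤ n → c ℕ.≤ d →
               ¬ (a / b <ᶠ c / d × c / d <ᶠ a' / b')

-- Partitions (Young diagrams, English convention): list of row lengths,
-- rows all positive and weakly decreasing top to bottom.
data Decreasing : List ℕ → Set where
  []  : Decreasing []
  [_] : ∀ x → Decreasing (x ∷ [])
  _∷_ : ∀ {x y ys} → y ℕ.≤ x → Decreasing (y ∷ ys) → Decreasing (x ∷ y ∷ ys)

data AllPos : List ℕ → Set where
  []  : AllPos []
  _∷_ : ∀ {x xs} → 1 ℕ.≤ x → AllPos xs → AllPos (x ∷ xs)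

record YoungDiagram (n : ℕ) : Set where
  field
    rows       : List ℕ
    decreasing : Decreasing rows
    positive   : AllPos rows
    size       : sum rows ≡ n

-- A box of a Young diagram in column i ≥ 1 and row j ≥ 1 has
-- coordinates (x , y) = (i , -j).  Row j is the list entry at index j-1.
IsBox : ∀ {n} → YoungDiagram n → ℤ × ℤ → Set
IsBox Y (x , y) =
  ∃[ r ] ∃[ i ] (1 ℕ.≤ i × i ℕ.≤ lookup (YoungDiagram.rows Y) r
               × x ≡ + i × y ≡ - (+ suc (toℕ r)))

weight : ℕ → ℕ → ℤ × ℤ → ℤ
weight a b (x , y) = (+ a) * x - ((+ b) - (+ a)) * y

module Submission where

-- Write b = a + B and b' = a' + B'.  On the box in column i and row j the
-- weight  a x - (b - a) y  equals the linear form  a·i + B·j  with natural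
-- coefficients, so the theorem says: the two forms  a·i + B·j  and
-- a'·i + B'·j  cannot order the two boxes oppositely.  Put u = i₂ - i₁ and
-- s = j₁ - j₂.  If u and s have opposite signs (the boxes are weakly
-- ordered coordinatewise) both forms order them the same way.  If the second
-- box lies to the left and below, the inversion would force the "slopes" to
-- compare the wrong way, contradicting a/b < a'/b'.  If it lies to the right
-- and above, the inversion says exactly that the fraction s/(u+s) lies
-- strictly between a/b and a'/b'; the Young diagram condition gives
-- u + s ≤ n, so this contradicts that a/b and a'/b' are Farey neighbours.

open import Defs
open import Data.Nat using (ℕ; _≥_)
open import Data.Integer using (ℤ; _<_; _>_)
open import Data.Product using (_×_)
open import Relation.Nullary using (¬_)

open import Data.Nat as ℕ using (suc; _+_; _*_; _≤_)
open import Data.Nat.Properties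
open import Data.Nat.Tactic.RingSolver using (solve-∀)
open import Data.Integer as ℤ using (+_; -_)
import Data.Integer.Properties as ℤP
import Data.Integer.Tactic.RingSolver as ℤRing
open import Data.Product using (_,_)
open import Data.Sum using (inj₁; inj₂)
open import Data.Empty using (⊥)
open import Relation.Nullary using (contradiction)
open import Data.List using (_∷_; length; lookup)
open import Data.Nat.ListAction using (sum)
open import Data.Fin using (Fin; toℕ; zero; suc)
open import Data.Fin.Properties using (toℕ<n)
open import Relation.Binary.PropositionalEquality

form : ℕ → ℕ → ℕ → ℕ → ℕ
form a B i j = a * i + B * j

form-right : ∀ a B i j u → form a B (i + u) j ≡ form a B i j + a * u
form-right = expand
  where
  expand : ∀ a B i j u → a * (i + u) + B * j ≡ (a * i + B * j) + a * u
  expand = solve-∀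

form-down : ∀ a B i j s → form a B i (j + s) ≡ form a B i j + B * s
form-down = expand
  where
  expand : ∀ a B i j s → a * i + B * (j + s) ≡ (a * i + B * j) + B * s
  expand = solve-∀

form-mono : ∀ a B {i i' j j'} → i ≤ i' → j ≤ j' → form a B i j ≤ form a B i' j'
form-mono a B i≤i' j≤j' = +-mono-≤ (*-monoʳ-≤ a i≤i') (*-monoʳ-≤ B j≤j')

right-above-down : ∀ a B i j u s →
  form a B i (j + s) ℕ.< form a B (i + u) j → B * s ℕ.< a * u
right-above-down a B i j u s h =
  +-cancelˡ-< (form a B i j) _ _ (subst₂ ℕ._<_ (form-down a B i j s) (form-right a B i j u) h)

down-above-right : ∀ a B i j u s →
  form a B (i + u) j ℕ.< form a B i (j + s) → a * u ℕ.< B * s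
down-above-right a B i j u s h =
  +-cancelˡ-< (form a B i j) _ _ (subst₂ ℕ._<_ (form-right a B i j u) (form-down a B i j s) h)

-- x/(x+y) versus s/(u+s) is decided by x·u versus y·s, because
-- y·s + x·(u+s) = x·u + s·(x+y).
mediant-identity : ∀ x y u s → y * s + x * (u + s) ≡ x * u + s * (x + y)
mediant-identity = solve-∀

below-fraction : ∀ x y u s → x * u ℕ.< y * s → x / (x + y) <ᶠ s / (u + s)
below-fraction x y u s h = +-cancelˡ-< (x * u) _ _ (begin-strict
  x * u + x * (u + s)  <⟨ +-monoˡ-< (x * (u + s)) h ⟩
  y * s + x * (u + s)  ≡⟨ mediant-identity x y u s ⟩
  x * u + s * (x + y)  ∎)
  where open ≤-Reasoning

above-fraction : ∀ x y u s → y * s ℕ.< x * u → s / (u + s) <ᶠ x / (x + y)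
above-fraction x y u s h = +-cancelˡ-< (y * s) _ _ (begin-strict
  y * s + s * (x + y)  <⟨ +-monoˡ-< (s * (x + y)) h ⟩
  x * u + s * (x + y)  ≡⟨ mediant-identity x y u s ⟨
  y * s + x * (u + s)  ∎)
  where open ≤-Reasoning

fraction-order : ∀ a B a' B' → a / (a + B) <ᶠ a' / (a' + B') → a * B' ℕ.< a' * B
fraction-order a B a' B' h =
  +-cancelˡ-< (a * a') _ _ (subst₂ ℕ._<_ (expandˡ a B a' B') (expandʳ a B a' B') h)
  where
  expandˡ : ∀ a B a' B' → a * (a' + B') ≡ a * a' + a * B'
  expandˡ = solve-∀
  expandʳ : ∀ a B a' B' → a' * (a + B) ≡ a * a' + a' * B
  expandʳ = solve-∀

-- A displacement T to the left and v down cannot be preferred by the form of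
-- slope B/a and rejected by the form of slope B'/a' when a·B' < a'·B:
-- multiplying  a'·T < B'·v  and  B·v < a·T  gives  a'·B < a·B'.
no-crossing : ∀ a B a' B' T v → a * B' ℕ.< a' * B →
  a' * T ℕ.< B' * v → B * v ℕ.< a * T → ⊥
no-crossing a B a' B' T v ordered h' h =
  <-asym ordered (*-cancelʳ-< (T * v) (a' * B) (a * B') product)
  where
  regroupˡ : ∀ a B a' B' T v → a' * T * (B * v) ≡ a' * B * (T * v)
  regroupˡ = solve-∀
  regroupʳ : ∀ a B a' B' T v → B' * v * (a * T) ≡ a * B' * (T * v)
  regroupʳ = solve-∀
  product : a' * B * (T * v) ℕ.< a * B' * (T * v)
  product = subst₂ ℕ._<_ (regroupˡ a B a' B' T v) (regroupʳ a B a' B' T v) (*-mono-< h' h)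

right-factor-pos : ∀ m n {k} → k ℕ.< m * n → 1 ≤ n
right-factor-pos m ℕ.zero {k} h = contradiction (subst (k ℕ.<_) (*-zeroʳ m) h) n≮0
right-factor-pos m (suc n) h = ℕ.s≤s ℕ.z≤n

-- No fraction s/(u+s) with u + s ≤ n lies strictly between two Farey
-- neighbours, so the slope comparisons a·u < B·s and B'·s < a'·u clash.
no-gap : ∀ {n a B a' B'} → FareyNeighbours n a (a + B) a' (a' + B') →
  ∀ u s → u + s ≤ n → a * u ℕ.< B * s → B' * s ℕ.< a' * u → ⊥
no-gap {a = a} {B} {a'} {B'} FN u s u+s≤n h h' =
  FareyNeighbours.adjacent FN s (u + s) den-pos u+s≤n (m≤n+m s u)
    (below-fraction a B u s h , above-fraction a' B' u s h')
  where
  den-pos : 1 ≤ u + s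
  den-pos = ≤-trans (right-factor-pos a' u h') (m≤m+n u s)

length≤sum : ∀ {xs} → AllPos xs → length xs ≤ sum xs
length≤sum AllPos.[] = ℕ.z≤n
length≤sum (p ∷ ps) = +-mono-≤ p (length≤sum ps)

-- Row r together with one box from each of the next s rows (which exist)
-- uses at most all the boxes.
row-and-below≤sum : ∀ {xs} → AllPos xs → (r : Fin (length xs)) → ∀ s →
  toℕ r + s ℕ.< length xs → lookup xs r + s ≤ sum xs
row-and-below≤sum {x ∷ _} (_ ∷ ps) zero s h =
  +-monoʳ-≤ x (≤-trans (≤-pred h) (length≤sum ps))
row-and-below≤sum {x ∷ xs} (_ ∷ ps) (suc r) s h =
  ≤-trans (row-and-below≤sum ps r s (≤-pred h)) (m≤n+m (sum xs) x)

box-room : ∀ {n} (Y : YoungDiagram n) r₁ r₂ i₁ i₂ →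
  i₂ ≤ lookup (YoungDiagram.rows Y) r₂ →
  ∀ u s → i₁ + u ≡ i₂ → suc (toℕ r₂) + s ≡ suc (toℕ r₁) → u + s ≤ n
box-room Y r₁ r₂ i₁ i₂ i₂≤row u s refl row-shift = begin
  u + s                          ≤⟨ +-monoˡ-≤ s (≤-trans (m≤n+m u i₁) i₂≤row) ⟩
  lookup (YoungDiagram.rows Y) r₂ + s
    ≤⟨ row-and-below≤sum (YoungDiagram.positive Y) r₂ s lower-row-exists ⟩
  sum (YoungDiagram.rows Y)      ≡⟨ YoungDiagram.size Y ⟩
  _                              ∎
  where
  open ≤-Reasoning
  lower-row-exists : toℕ r₂ + s ℕ.< length (YoungDiagram.rows Y)
  lower-row-exists = subst (ℕ._< _) (sym (suc-injective row-shift)) (toℕ<n r₁)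

no-inversion : ∀ {n a B a' B'} → FareyNeighbours n a (a + B) a' (a' + B') →
  ∀ i₁ j₁ i₂ j₂ → (∀ u s → i₁ + u ≡ i₂ → j₂ + s ≡ j₁ → u + s ≤ n) →
  form a' B' i₁ j₁ ℕ.< form a' B' i₂ j₂ → form a B i₂ j₂ ℕ.< form a B i₁ j₁ → ⊥
no-inversion {a = a} {B} {a'} {B'} FN i₁ j₁ i₂ j₂ room h' h
  with ≤-total i₁ i₂ | ≤-total j₁ j₂
... | inj₁ i₁≤i₂ | inj₁ j₁≤j₂ = <⇒≱ h (form-mono a B i₁≤i₂ j₁≤j₂)
... | inj₂ i₂≤i₁ | inj₂ j₂≤j₁ = <⇒≱ h' (form-mono a' B' i₂≤i₁ j₂≤j₁)
... | inj₁ i₁≤i₂ | inj₂ j₂≤j₁ with m≤n⇒∃[o]m+o≡n i₁≤i₂ | m≤n⇒∃[o]m+o≡n j₂≤j₁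
...   | u , refl | s , refl =
  no-gap FN u s (room u s refl refl)
    (down-above-right a B i₁ j₂ u s h) (right-above-down a' B' i₁ j₂ u s h')
no-inversion {a = a} {B} {a'} {B'} FN i₁ j₁ i₂ j₂ room h' h
  | inj₂ i₂≤i₁ | inj₁ j₁≤j₂ with m≤n⇒∃[o]m+o≡n i₂≤i₁ | m≤n⇒∃[o]m+o≡n j₁≤j₂
...   | T , refl | v , refl =
  no-crossing a B a' B' T v (fraction-order a B a' B' (FareyNeighbours.ordered FN))
    (down-above-right a' B' i₂ j₁ T v h') (right-above-down a B i₂ j₁ T v h)

weight-box : ∀ a B i j → weight a (a + B) (+ i , - (+ j)) ≡ + form a B i j
weight-box a B i j = begin
  + a ℤ.* + i ℤ.- (+ (a + B) ℤ.- + a) ℤ.* - (+ j) ≡⟨ cong (λ b → + a ℤ.* + i ℤ.- (b ℤ.- + a) ℤ.* - (+ j)) (ℤP.pos-+ a B) ⟩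
  + a ℤ.* + i ℤ.- (+ a ℤ.+ + B ℤ.- + a) ℤ.* - (+ j) ≡⟨ simplify (+ a) (+ B) (+ i) (+ j) ⟩
  + a ℤ.* + i ℤ.+ + B ℤ.* + j                      ≡⟨ sym (cong₂ ℤ._+_ (ℤP.pos-* a i) (ℤP.pos-* B j)) ⟩
  + (a * i) ℤ.+ + (B * j)                          ≡⟨ sym (ℤP.pos-+ (a * i) (B * j)) ⟩
  + form a B i j                                   ∎
  where
  open ≡-Reasoning
  simplify : ∀ a B i j → a ℤ.* i ℤ.- (a ℤ.+ B ℤ.- a) ℤ.* (- j) ≡ a ℤ.* i ℤ.+ B ℤ.* j
  simplify = ℤRing.solve-∀

weight-order : ∀ a B i₁ j₁ i₂ j₂ →
  weight a (a + B) (+ i₁ , - (+ j₁)) < weight a (a + B) (+ i₂ , - (+ j₂)) →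
  form a B i₁ j₁ ℕ.< form a B i₂ j₂
weight-order a B i₁ j₁ i₂ j₂ h =
  ℤP.drop‿+<+ (subst₂ _<_ (weight-box a B i₁ j₁) (weight-box a B i₂ j₂) h)

mainTheorem1 : (n : ℕ) → n ≥ 1 → (a b a' b' : ℕ) → FareyNeighbours n a b a' b' →
    (Y : YoungDiagram n) → (p₁ p₂ : ℤ × ℤ) → IsBox Y p₁ → IsBox Y p₂ →
    ¬ (weight a' b' p₁ < weight a' b' p₂ × weight a b p₁ > weight a b p₂)
mainTheorem1 n _ a b a' b' FN Y _ _
  (r₁ , i₁ , _ , _ , refl , refl) (r₂ , i₂ , _ , i₂≤row , refl , refl) (h' , h)
  with m≤n⇒∃[o]m+o≡n (FareyTerm.num≤den (FareyNeighbours.left FN))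
     | m≤n⇒∃[o]m+o≡n (FareyTerm.num≤den (FareyNeighbours.right FN))
... | B , refl | B' , refl =
  no-inversion FN i₁ j₁ i₂ j₂ (box-room Y r₁ r₂ i₁ i₂ i₂≤row)
    (weight-order a' B' i₁ j₁ i₂ j₂ h') (weight-order a B i₂ j₂ i₁ j₁ h)
  where
  j₁ = suc (toℕ r₁)
  j₂ = suc (toℕ r₂)
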